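{- Let $p$ be an odd prime such that $2$ is a semiprimitive root of $p$, i.e. $2$ has multiplicative order exactly $\frac{p-1}{2}$ modulo $p$ and the congruence $2^y\equiv -1 \pmod p$ has no integer solution $y$. Then for every natural number $x$, $$S_p(2^p x) = (-1)^{\frac{p-1}{2}}\, p\, S_p(2x).$$
   Context: For $m, x \in \mathbb{N}$, the Newman sum is $S_m(x)=\sum_{0\le n<x,\ n\equiv 0 \pmod m} (-1)^{\sigma(n)}$, where $\sigma(n)$ denotes the number of 1's in the binary expansion of $n$. -}

module Defs where

open import Data.Nat using (ℕ; zero; suc; _+_; _*_; _∸_; _^_; _<_; _%_; _/_)
open import Data.Nat.Divisibility using (_∣_; _∣?_)
open import Data.Bool using (Bool; true; false; if_then_else_)
open import Data.Integer as ℤ using (ℤ)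
open import Relation.Nullary using (¬_; yes; no)
open import Data.Product using (_×_)
open import Data.Nat using (_≟_)
open import Data.Nat.Properties using (_≤?_)

bitsumAux : ℕ → ℕ → ℕ
bitsumAux zero    n = zero
bitsumAux (suc k) n = n % 2 + bitsumAux k (n / 2)

-- fuel n suffices since n / 2 < n for n > 0 and n halves at each step
σ : ℕ → ℕ
σ n = bitsumAux n n

negOnePow : ℕ → ℤ
negOnePow zero = ℤ.+ 1
negOnePow (suc k) = ℤ.- negOnePow k

S : ℕ → ℕ → ℤ
S m zero = ℤ.+ 0
S m (suc x) with m ∣? x
... | yes _ = S m x ℤ.+ negOnePow (σ x)
... | no  _ = S m x

HasOrder : ℕ → ℕ → ℕ → Set
HasOrder a p k = (0 < k) × (p ∣ a ^ k ∸ 1) × (∀ j → 0 < j → j < k → ¬ (p ∣ a ^ j ∸ 1))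

{-# OPTIONS --safe #-}
-- Put T_k(c) = ∑_{r < 2^k} (-1)^σ(r) [p ∣ r - c]. Cutting [0, 2^k x) into blocks of length 2^k gives
-- S_p(2^k x) = ∑_{q < x} (-1)^σ(q) T_k(-2^k q), and T_k = ∏_{i < k} (1 - z^(2^i)) δ, where δ is the indicator
-- of pℤ and zᵃ shifts functions on ℤ by a, so that only exponents modulo p matter.
-- As 2 has order m = (p-1)/2 modulo p and no power of 2 is ≡ -1, the exponents 2^0, ..., 2^(p-1) are 1 followed
-- twice by a set H with -H ∪ H the nonzero residues, and ∑ H = 2^m - 1 ≡ 0. Hence ∏_{h ∈ H} (1 - zʰ) equals
-- (-1)^m ∏_{h ∈ H} (1 - z^(-h)), and T_p = (-1)^m (1 - z) ∏_{a ≢ 0} (1 - zᵃ) δ.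
-- Finally ∏_{a ≢ 0} (1 - zᵃ) δ = p δ - 1: in ∏_a (1 + y zᵃ) the number of k-subsets of ℤ/p with sum c is
-- unchanged when every element is shifted by 1, which adds k to the sum, so for 0 < k < p it does not depend on c.
-- Thus T_p = (-1)^m p T_1, and T_1 is p-periodic while 2^p q ≡ 2q.
module Submission where

module Newman where
  open import Level using (Level; 0ℓ)
  open import Data.Nat as ℕ using (ℕ; zero; suc; _≤_; _<_; z≤n; s≤s; _^_; _%_; _/_; _∸_; NonZero; NonTrivial)
  import Data.Nat.Properties as ℕP
  open import Data.Nat.DivMod
    using (m≡m%n+[m/n]*n; m%n<n; m*n/n≡m; m*n%n≡0; [m+kn]%n≡m%n; +-distrib-/-∣ʳ; m/n<m; m<n*o⇒m/o<n)
  import Data.Nat.Divisibility as ℕD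
  open import Data.Nat.Primality using (Prime; euclidsLemma; prime⇒irreducible; prime⇒nonZero; prime⇒nonTrivial)
  open import Data.Nat.Coprimality using (Coprime; prime⇒coprime; coprime-Bézout)
  open import Data.Nat.GCD using (module Bézout)
  import Data.Nat.Tactic.RingSolver as ℕRing
  open import Data.Integer as ℤ using (ℤ; +_; -[1+_]; _+_; _-_; -_; _*_; 0ℤ; 1ℤ; -1ℤ)
  import Data.Integer.Properties as ℤP
  open import Data.Integer.DivMod using (_%ℕ_; _/ℕ_; a≡a%ℕn+[a/ℕn]*n; n%ℕd<d)
  open import Data.Integer.Divisibility.Signed as ℤD using (_∣_; divides)
  open import Data.Integer.Tactic.RingSolver using (solve-∀)
  open import Data.List using (List; []; _∷_; _++_; [_]; map; length; foldr; applyUpTo; applyDownFrom)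
  open import Data.List.Properties
    using (length-++; length-map; length-applyUpTo; length-applyDownFrom; map-applyUpTo; applyUpTo-∷ʳ; ++-identityʳ)
  open import Data.List.Relation.Unary.All as All using (All; []; _∷_)
  open import Data.List.Relation.Unary.Any using (Any; here; there)
  open import Data.List.Relation.Unary.AllPairs using (AllPairs; []; _∷_)
  open import Data.List.Relation.Binary.Pointwise as Pointwise using (Pointwise; []; _∷_)
  open import Data.List.Relation.Binary.Pointwise.Properties using (Pointwise-length)
  open import Data.List.Relation.Binary.Permutation.Homogeneous as Perm using (Permutation)
  import Data.List.Relation.Binary.Permutation.Setoid.Properties as ↭ₛ
  import Data.List.Relation.Binary.Equality.Setoid as ≋ₛ
  import Data.List.Relation.Unary.Any.Properties as AnyP
  import Data.List.Relation.Unary.All.Properties as AllP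
  import Data.List.Relation.Unary.AllPairs.Properties as AllPairsP
  open import Data.Product using (_×_; _,_; proj₁; proj₂)
  open import Data.Sum using (inj₁; inj₂)
  open import Data.Empty using (⊥-elim)
  open import Relation.Binary.Bundles using (Setoid)
  open import Relation.Nullary using (¬_; Dec; yes; no)
  open import Relation.Binary.PropositionalEquality
    using (_≡_; _≢_; _≗_; refl; sym; trans; cong; cong₂; subst; subst₂; module ≡-Reasoning)
  open import Defs using (bitsumAux; σ; negOnePow; S; HasOrder)

  -- Binary digit sums and the Thue–Morse sequence

  bitsumAux-zero : ∀ k → bitsumAux k 0 ≡ 0
  bitsumAux-zero zero = refl
  bitsumAux-zero (suc k) = bitsumAux-zero k

  /2-≤ : ∀ n k → n ≤ suc k → n / 2 ≤ k
  /2-≤ zero k _ = z≤n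
  /2-≤ (suc n) k n≤1+k = ℕP.m<1+n⇒m≤n (ℕP.<-≤-trans (m/n<m (suc n) 2 (s≤s (s≤s z≤n))) n≤1+k)

  bitsumAux-fuel : ∀ k k' n → n ≤ k → n ≤ k' → bitsumAux k n ≡ bitsumAux k' n
  bitsumAux-fuel zero k' zero _ _ = sym (bitsumAux-zero k')
  bitsumAux-fuel (suc k) zero zero _ _ = bitsumAux-zero (suc k)
  bitsumAux-fuel (suc k) (suc k') n n≤1+k n≤1+k' =
    cong (n % 2 ℕ.+_) (bitsumAux-fuel k k' (n / 2) (/2-≤ n k n≤1+k) (/2-≤ n k' n≤1+k'))

  σ-suc : ∀ n → σ (suc n) ≡ suc n % 2 ℕ.+ σ (suc n / 2)
  σ-suc n = cong (suc n % 2 ℕ.+_) (bitsumAux-fuel n (suc n / 2) (suc n / 2) (/2-≤ (suc n) n ℕP.≤-refl) ℕP.≤-refl)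

  σ-bit : ∀ b n → b < 2 → σ (b ℕ.+ n ℕ.* 2) ≡ b ℕ.+ σ n
  σ-bit zero zero _ = refl
  σ-bit zero (suc n) _ =
    trans (σ-suc (suc (n ℕ.* 2))) (cong₂ ℕ._+_ (m*n%n≡0 (suc n) 2) (cong σ (m*n/n≡m (suc n) 2)))
  σ-bit (suc zero) n _ =
    trans (σ-suc (n ℕ.* 2))
      (cong₂ ℕ._+_ ([m+kn]%n≡m%n 1 n 2) (cong σ (trans (+-distrib-/-∣ʳ 1 {n ℕ.* 2} {2} (ℕD.divides n refl)) (m*n/n≡m n 2))))
  σ-bit (suc (suc _)) _ (s≤s (s≤s ()))

  σ-split : ∀ k q r → r < 2 ^ k → σ (2 ^ k ℕ.* q ℕ.+ r) ≡ σ q ℕ.+ σ r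
  σ-split zero q zero _ = trans (cong σ (trans (ℕP.+-identityʳ (1 ℕ.* q)) (ℕP.*-identityˡ q))) (sym (ℕP.+-identityʳ (σ q)))
  σ-split zero _ (suc _) (s≤s ())
  σ-split (suc k) q r r<2^[1+k] = begin
      σ (2 ^ suc k ℕ.* q ℕ.+ r)           ≡⟨ cong σ (trans (cong (2 ^ suc k ℕ.* q ℕ.+_) r≡) (regroup (2 ^ k) q b r')) ⟩
      σ (b ℕ.+ (2 ^ k ℕ.* q ℕ.+ r') ℕ.* 2) ≡⟨ σ-bit b (2 ^ k ℕ.* q ℕ.+ r') (m%n<n r 2) ⟩
      b ℕ.+ σ (2 ^ k ℕ.* q ℕ.+ r')         ≡⟨ cong (b ℕ.+_) (σ-split k q r' r'<2^k) ⟩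
      b ℕ.+ (σ q ℕ.+ σ r')                 ≡⟨ swap-front b (σ q) (σ r') ⟩
      σ q ℕ.+ (b ℕ.+ σ r')                 ≡⟨ cong (σ q ℕ.+_) (σ-bit b r' (m%n<n r 2)) ⟨
      σ q ℕ.+ σ (b ℕ.+ r' ℕ.* 2)           ≡⟨ cong (λ z → σ q ℕ.+ σ z) (sym r≡) ⟩
      σ q ℕ.+ σ r                          ∎
    where
    open ≡-Reasoning
    b : ℕ
    b = r % 2
    r' : ℕ
    r' = r / 2
    r≡ : r ≡ b ℕ.+ r' ℕ.* 2
    r≡ = m≡m%n+[m/n]*n r 2
    r'<2^k : r' < 2 ^ k
    r'<2^k = m<n*o⇒m/o<n (subst (r <_) (ℕP.*-comm 2 (2 ^ k)) r<2^[1+k])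
    regroup : ∀ P q b r' → (2 ℕ.* P) ℕ.* q ℕ.+ (b ℕ.+ r' ℕ.* 2) ≡ b ℕ.+ (P ℕ.* q ℕ.+ r') ℕ.* 2
    regroup = ℕRing.solve-∀
    swap-front : ∀ b x y → b ℕ.+ (x ℕ.+ y) ≡ x ℕ.+ (b ℕ.+ y)
    swap-front = ℕRing.solve-∀

  thueMorse : ℕ → ℤ
  thueMorse n = negOnePow (σ n)

  negOnePow-+ : ∀ i j → negOnePow (i ℕ.+ j) ≡ negOnePow i * negOnePow j
  negOnePow-+ zero j = sym (ℤP.*-identityˡ _)
  negOnePow-+ (suc i) j = trans (cong -_ (negOnePow-+ i j)) (ℤP.neg-distribˡ-* (negOnePow i) (negOnePow j))

  negOnePow-square : ∀ k → negOnePow k * negOnePow k ≡ 1ℤ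
  negOnePow-square zero = refl
  negOnePow-square (suc k) = trans (neg*neg (negOnePow k)) (negOnePow-square k)
    where
    neg*neg : ∀ s → - s * - s ≡ s * s
    neg*neg = solve-∀

  thueMorse-split : ∀ k q r → r < 2 ^ k → thueMorse (2 ^ k ℕ.* q ℕ.+ r) ≡ thueMorse q * thueMorse r
  thueMorse-split k q r r< = trans (cong negOnePow (σ-split k q r r<)) (negOnePow-+ (σ q) (σ r))

  thueMorse-flip : ∀ k r → r < 2 ^ k → thueMorse (2 ^ k ℕ.+ r) ≡ - thueMorse r
  thueMorse-flip k r r< = begin
      thueMorse (2 ^ k ℕ.+ r)          ≡⟨ cong (λ n → thueMorse (n ℕ.+ r)) (sym (ℕP.*-identityʳ (2 ^ k))) ⟩
      thueMorse (2 ^ k ℕ.* 1 ℕ.+ r)    ≡⟨ thueMorse-split k 1 r r< ⟩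
      -1ℤ * thueMorse r                ≡⟨ ℤP.-1*i≡-i (thueMorse r) ⟩
      - thueMorse r                    ∎
    where open ≡-Reasoning

  ∑ : ℕ → (ℕ → ℤ) → ℤ
  ∑ zero g = 0ℤ
  ∑ (suc n) g = ∑ n g + g n

  ∑-cong : ∀ n {g h : ℕ → ℤ} → (∀ r → r < n → g r ≡ h r) → ∑ n g ≡ ∑ n h
  ∑-cong zero _ = refl
  ∑-cong (suc n) g≡h = cong₂ _+_ (∑-cong n (λ r r<n → g≡h r (ℕP.m<n⇒m<1+n r<n))) (g≡h n ℕP.≤-refl)

  ∑-+ : ∀ m n g → ∑ (m ℕ.+ n) g ≡ ∑ m g + ∑ n (λ r → g (m ℕ.+ r))
  ∑-+ m zero g = trans (cong (λ k → ∑ k g) (ℕP.+-identityʳ m)) (sym (ℤP.+-identityʳ _))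
  ∑-+ m (suc n) g = begin
      ∑ (m ℕ.+ suc n) g                                        ≡⟨ cong (λ k → ∑ k g) (ℕP.+-suc m n) ⟩
      ∑ (m ℕ.+ n) g + g (m ℕ.+ n)                              ≡⟨ cong (_+ g (m ℕ.+ n)) (∑-+ m n g) ⟩
      ∑ m g + ∑ n (λ r → g (m ℕ.+ r)) + g (m ℕ.+ n)            ≡⟨ ℤP.+-assoc (∑ m g) _ _ ⟩
      ∑ m g + ∑ (suc n) (λ r → g (m ℕ.+ r))                    ∎
    where open ≡-Reasoning

  ∑-blocks : ∀ m x g → ∑ (m ℕ.* x) g ≡ ∑ x (λ q → ∑ m (λ r → g (m ℕ.* q ℕ.+ r)))
  ∑-blocks m zero g = cong (λ k → ∑ k g) (ℕP.*-zeroʳ m)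
  ∑-blocks m (suc x) g = begin
      ∑ (m ℕ.* suc x) g
        ≡⟨ cong (λ k → ∑ k g) (trans (ℕP.*-suc m x) (ℕP.+-comm m _)) ⟩
      ∑ (m ℕ.* x ℕ.+ m) g
        ≡⟨ ∑-+ (m ℕ.* x) m g ⟩
      ∑ (m ℕ.* x) g + ∑ m (λ r → g (m ℕ.* x ℕ.+ r))
        ≡⟨ cong (_+ ∑ m (λ r → g (m ℕ.* x ℕ.+ r))) (∑-blocks m x g) ⟩
      ∑ (suc x) (λ q → ∑ m (λ r → g (m ℕ.* q ℕ.+ r))) ∎
    where open ≡-Reasoning

  ∑-*ˡ : ∀ n s g → ∑ n (λ r → s * g r) ≡ s * ∑ n g
  ∑-*ˡ zero s g = sym (ℤP.*-zeroʳ s)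
  ∑-*ˡ (suc n) s g = trans (cong (_+ s * g n) (∑-*ˡ n s g)) (sym (ℤP.*-distribˡ-+ s _ _))

  ∑-+-distrib : ∀ n g h → ∑ n (λ r → g r + h r) ≡ ∑ n g + ∑ n h
  ∑-+-distrib zero g h = refl
  ∑-+-distrib (suc n) g h = trans (cong (_+ (g n + h n)) (∑-+-distrib n g h)) (interchange (∑ n g) (∑ n h) (g n) (h n))
    where
    interchange : ∀ w x y z → w + x + (y + z) ≡ w + y + (x + z)
    interchange = solve-∀

  ∑-const : ∀ n c → ∑ n (λ _ → c) ≡ + n * c
  ∑-const zero c = sym (ℤP.*-zeroˡ c)
  ∑-const (suc n) c = trans (cong (_+ c) (∑-const n c)) (distrib (+ n) c)
    where
    distrib : ∀ n c → n * c + c ≡ (1ℤ + n) * c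
    distrib = solve-∀

  module _ {c ℓ : Level} (A : Setoid c ℓ) where
    open Setoid A using (_≈_) renaming (sym to ≈-sym; trans to ≈-trans)
    open import Data.List.Relation.Binary.Equality.Setoid A using (≋-sym)
    open import Data.List.Relation.Binary.Permutation.Setoid A using (_↭_; ↭-refl; ↭-sym; ↭-trans; ↭-reflexive-≋)
    open import Data.List.Relation.Binary.Permutation.Setoid.Properties A using (↭-shift; xs↭ys⇒|xs|≡|ys|)
    open import Data.List.Membership.Setoid A using (_∈_)
    open import Data.List.Membership.Setoid.Properties using (∈-∃++; ∈-resp-≋; ∈-++⁻; ∈-++⁺ˡ; ∈-++⁺ʳ)

    distinct-⊆⇒↭ : ∀ {xs ys} → AllPairs (λ x y → ¬ x ≈ y) xs → All (_∈ ys) xs → length xs ≡ length ys → xs ↭ ys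
    distinct-⊆⇒↭ {[]} {[]} _ _ _ = ↭-refl
    distinct-⊆⇒↭ {x ∷ xs} {ys} (x≉xs ∷ xs-distinct) (x∈ys ∷ xs⊆ys) |x∷xs|≡|ys| with ∈-∃++ A x∈ys
    ... | as , bs , w , x≈w , ys≋as++w∷bs =
      ↭-trans (Perm.prep x≈w (distinct-⊆⇒↭ xs-distinct (All.zipWith avoid-w (x≉xs , xs⊆ys)) |xs|≡|as++bs|))
        (↭-trans (↭-sym (↭-shift as bs)) (↭-reflexive-≋ (≋-sym ys≋as++w∷bs)))
      where
      avoid-w : ∀ {y} → (¬ x ≈ y) × y ∈ ys → y ∈ as ++ bs
      avoid-w (x≉y , y∈ys) with ∈-++⁻ A as (∈-resp-≋ A ys≋as++w∷bs y∈ys)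
      ... | inj₁ y∈as = ∈-++⁺ˡ A y∈as
      ... | inj₂ (here y≈w) = ⊥-elim (x≉y (≈-trans x≈w (≈-sym y≈w)))
      ... | inj₂ (there y∈bs) = ∈-++⁺ʳ A as y∈bs
      |xs|≡|as++bs| : length xs ≡ length (as ++ bs)
      |xs|≡|as++bs| = ℕP.suc-injective
        (trans |x∷xs|≡|ys| (trans (Pointwise-length ys≋as++w∷bs) (xs↭ys⇒|xs|≡|ys| (↭-shift as bs))))

  -- Periodic functions and congruences

  Periodic : ℤ → (ℤ → ℤ) → Set
  Periodic d F = ∀ c → F (c + d) ≡ F c

  Constant : (ℤ → ℤ) → Set
  Constant F = ∀ x y → F x ≡ F y

  infix 4 _≡_mod_

  record _≡_mod_ (x y d : ℤ) : Set where
    constructor congruence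
    field
      divisibility : d ∣ x - y

  open _≡_mod_

  ≡⇒≡mod : ∀ {d x y} → x ≡ y → x ≡ y mod d
  ≡⇒≡mod {d} {x} refl = congruence (divides 0ℤ (trans (ℤP.+-inverseʳ x) (sym (ℤP.*-zeroˡ d))))

  ≡mod-sym : ∀ {d x y} → x ≡ y mod d → y ≡ x mod d
  ≡mod-sym {d} {x} {y} (congruence d∣x-y) = congruence (subst (d ∣_) (negate x y) (ℤD.∣m⇒∣-m d∣x-y))
    where
    negate : ∀ x y → - (x - y) ≡ y - x
    negate = solve-∀

  ≡mod-trans : ∀ {d x y z} → x ≡ y mod d → y ≡ z mod d → x ≡ z mod d
  ≡mod-trans {d} {x} {y} {z} (congruence d∣x-y) (congruence d∣y-z) =
    congruence (subst (d ∣_) (chain x y z) (ℤD.∣m∣n⇒∣m+n d∣x-y d∣y-z))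
    where
    chain : ∀ x y z → (x - y) + (y - z) ≡ x - z
    chain = solve-∀

  ≡mod-neg : ∀ {d x y} → x ≡ y mod d → - x ≡ - y mod d
  ≡mod-neg {d} {x} {y} (congruence d∣x-y) = congruence (subst (d ∣_) (negate x y) (ℤD.∣m⇒∣-m d∣x-y))
    where
    negate : ∀ x y → - (x - y) ≡ - x - - y
    negate = solve-∀

  ≡mod-*ˡ : ∀ {d x y} z → x ≡ y mod d → z * x ≡ z * y mod d
  ≡mod-*ˡ {d} {x} {y} z (congruence d∣x-y) = congruence (subst (d ∣_) (distrib z x y) (ℤD.∣n⇒∣m*n z d∣x-y))
    where
    distrib : ∀ z x y → z * (x - y) ≡ z * x - z * y
    distrib = solve-∀

  mod-setoid : ℤ → Setoid 0ℓ 0ℓ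
  mod-setoid d = record
    { _≈_ = _≡_mod d
    ; isEquivalence = record
        { refl = ≡⇒≡mod refl
        ; sym = ≡mod-sym
        ; trans = ≡mod-trans
        }
    }

  periodic-+ℕ* : ∀ {d F} → Periodic d F → ∀ n c → F (c + + n * d) ≡ F c
  periodic-+ℕ* {d} {F} F-per zero c = cong F (trans (cong (λ w → c + w) (ℤP.*-zeroˡ d)) (ℤP.+-identityʳ c))
  periodic-+ℕ* {d} {F} F-per (suc n) c = begin
      F (c + + suc n * d)      ≡⟨ cong F (step c (+ n) d) ⟩
      F (c + + n * d + d)      ≡⟨ F-per _ ⟩
      F (c + + n * d)          ≡⟨ periodic-+ℕ* F-per n c ⟩
      F c                      ∎
    where
    open ≡-Reasoning
    step : ∀ c n d → c + (1ℤ + n) * d ≡ c + n * d + d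
    step = solve-∀

  periodic-+* : ∀ {d F} → Periodic d F → ∀ z c → F (c + z * d) ≡ F c
  periodic-+* F-per (+ n) c = periodic-+ℕ* F-per n c
  periodic-+* {d} {F} F-per -[1+ n ] c = begin
      F (c + -[1+ n ] * d)                      ≡⟨ periodic-+ℕ* F-per (suc n) _ ⟨
      F (c + -[1+ n ] * d + + suc n * d)        ≡⟨ cong F (cancel c (+ suc n) d) ⟩
      F c                                       ∎
    where
    open ≡-Reasoning
    cancel : ∀ c n d → c + (- n) * d + n * d ≡ c
    cancel = solve-∀

  periodic-resp : ∀ {d F x y} → Periodic d F → x ≡ y mod d → F x ≡ F y
  periodic-resp {d} {F} {x} {y} F-per (congruence (divides q x-y≡qd)) = begin
      F x              ≡⟨ cong F (split x y) ⟩
      F (y + (x - y))  ≡⟨ cong (λ z → F (y + z)) x-y≡qd ⟩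
      F (y + q * d)    ≡⟨ periodic-+* F-per q y ⟩
      F y              ∎
    where
    open ≡-Reasoning
    split : ∀ x y → x ≡ y + (x - y)
    split = solve-∀

  constant-from-Bézout : ∀ {a b F} → Periodic (+ a) F → Periodic (+ b) F →
                         ∀ u v → 1 ℕ.+ v ℕ.* b ≡ u ℕ.* a → Constant F
  constant-from-Bézout {a} {b} {F} a-per b-per u v bézout x y = begin
      F x                                                  ≡⟨ periodic-+* a-per (gap * + u) x ⟨
      F (x + gap * + u * + a)                              ≡⟨ periodic-+* b-per (- (gap * + v)) _ ⟨
      F (x + gap * + u * + a + - (gap * + v) * + b)        ≡⟨ cong F (expand x gap (+ u) (+ a) (+ v) (+ b)) ⟩
      F (x + gap * (+ u * + a) - gap * (+ v * + b))        ≡⟨ cong (λ w → F (x + gap * w - gap * (+ v * + b))) ua≡1+vb ⟨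
      F (x + gap * (1ℤ + + v * + b) - gap * (+ v * + b))   ≡⟨ cong F (collapse x y (+ v * + b)) ⟩
      F y                                                  ∎
    where
    open ≡-Reasoning
    gap : ℤ
    gap = y - x
    ua≡1+vb : 1ℤ + + v * + b ≡ + u * + a
    ua≡1+vb = trans (cong (λ w → 1ℤ + w) (sym (ℤP.pos-* v b)))
                (trans (sym (ℤP.pos-+ 1 (v ℕ.* b))) (trans (cong +_ bézout) (ℤP.pos-* u a)))
    expand : ∀ x g u a v b → x + g * u * a + - (g * v) * b ≡ x + g * (u * a) - g * (v * b)
    expand = solve-∀
    collapse : ∀ x y w → x + (y - x) * (1ℤ + w) - (y - x) * w ≡ y
    collapse = solve-∀

  periodic-coprime : ∀ {a b F} → Coprime a b → Periodic (+ a) F → Periodic (+ b) F → Constant F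
  periodic-coprime a⊥b a-per b-per with coprime-Bézout a⊥b
  ... | Bézout.+- u v eq = constant-from-Bézout a-per b-per u v eq
  ... | Bézout.-+ u v eq = constant-from-Bézout b-per a-per v u eq

  -- Reading F : ℤ → ℤ as the formal series ∑ F c zᶜ, Δ a F is (1 - zᵃ) F

  Δ : ℤ → (ℤ → ℤ) → ℤ → ℤ
  Δ a F c = F c - F (c - a)

  Δ* : List ℤ → (ℤ → ℤ) → ℤ → ℤ
  Δ* [] F = F
  Δ* (a ∷ as) F = Δ a (Δ* as F)

  Δ*-cong : ∀ as {F G} → F ≗ G → Δ* as F ≗ Δ* as G
  Δ*-cong [] F≗G = F≗G
  Δ*-cong (a ∷ as) F≗G c = cong₂ _-_ (Δ*-cong as F≗G c) (Δ*-cong as F≗G (c - a))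

  Δ*-++ : ∀ as bs F → Δ* (as ++ bs) F ≗ Δ* as (Δ* bs F)
  Δ*-++ [] bs F c = refl
  Δ*-++ (a ∷ as) bs F c = cong₂ _-_ (Δ*-++ as bs F c) (Δ*-++ as bs F (c - a))

  Δ*-periodic : ∀ {d} as {F} → Periodic d F → Periodic d (Δ* as F)
  Δ*-periodic [] F-per = F-per
  Δ*-periodic {d} (a ∷ as) {F} F-per c =
    cong₂ _-_ (G-per c) (trans (cong G (reorder c d a)) (G-per (c - a)))
    where
    G : ℤ → ℤ
    G = Δ* as F
    G-per : Periodic d G
    G-per = Δ*-periodic as F-per
    reorder : ∀ c d a → c + d - a ≡ c - a + d
    reorder = solve-∀

  Δ*-neg : ∀ as F c → Δ* (map -_ as) F c ≡ negOnePow (length as) * Δ* as F (c + foldr _+_ 0ℤ as)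
  Δ*-neg [] F c = trans (cong F (sym (ℤP.+-identityʳ c))) (sym (ℤP.*-identityˡ _))
  Δ*-neg (a ∷ as) F c = begin
      Δ* (map -_ as) F c - Δ* (map -_ as) F (c - - a)
        ≡⟨ cong₂ _-_ (Δ*-neg as F c) (Δ*-neg as F (c - - a)) ⟩
      s * G (c + Σ) - s * G (c - - a + Σ)
        ≡⟨ cong₂ (λ x y → s * G x - s * G y) (shift₁ c a Σ) (shift₂ c a Σ) ⟩
      s * G (c + (a + Σ) - a) - s * G (c + (a + Σ))
        ≡⟨ flip s (G (c + (a + Σ) - a)) (G (c + (a + Σ))) ⟩
      - s * (G (c + (a + Σ)) - G (c + (a + Σ) - a))  ∎
    where
    open ≡-Reasoning
    s : ℤ
    s = negOnePow (length as)
    G : ℤ → ℤ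
    G = Δ* as F
    Σ : ℤ
    Σ = foldr _+_ 0ℤ as
    shift₁ : ∀ c a Σ → c + Σ ≡ c + (a + Σ) - a
    shift₁ = solve-∀
    shift₂ : ∀ c a Σ → c - - a + Σ ≡ c + (a + Σ)
    shift₂ = solve-∀
    flip : ∀ s x y → s * x - s * y ≡ - s * (y - x)
    flip = solve-∀

  ∑-Δ₁-periodic : ∀ n {G} → Periodic (+ suc n) G → ∑ (suc n) (λ r → Δ 1ℤ G (+ r)) ≡ 0ℤ
  ∑-Δ₁-periodic n {G} G-per = begin
      ∑ (suc n) (λ r → Δ 1ℤ G (+ r))  ≡⟨ telescope n ⟩
      G (+ n) - G -1ℤ                 ≡⟨ cong (λ x → G (+ n) - x) (G-per -1ℤ) ⟨
      G (+ n) - G (-1ℤ + + suc n)     ≡⟨ ℤP.+-inverseʳ (G (+ n)) ⟩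
      0ℤ                              ∎
    where
    open ≡-Reasoning
    telescope : ∀ k → ∑ (suc k) (λ r → Δ 1ℤ G (+ r)) ≡ G (+ k) - G -1ℤ
    telescope zero = ℤP.+-identityˡ _
    telescope (suc k) = begin
        ∑ (suc k) (λ r → Δ 1ℤ G (+ r)) + (G (+ suc k) - G (+ suc k - 1ℤ))
          ≡⟨ cong₂ (λ x y → x + (G (+ suc k) - G y)) (telescope k) (trans (cong (_- 1ℤ) (ℤP.pos-+ 1 k)) (pred-suc (+ k))) ⟩
        G (+ k) - G -1ℤ + (G (+ suc k) - G (+ k))
          ≡⟨ collapse (G (+ k)) (G -1ℤ) (G (+ suc k)) ⟩
        G (+ suc k) - G -1ℤ  ∎
      where
      pred-suc : ∀ x → 1ℤ + x - 1ℤ ≡ x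
      pred-suc = solve-∀
      collapse : ∀ x y z → x - y + (z - x) ≡ z - y
      collapse = solve-∀

  -- F : ℤ → ℕ → ℤ stands for the formal series ∑ F c k yᵏ zᶜ; Δ⁺ a multiplies it by 1 + y zᵃ

  infix 4 _≗₂_

  _≗₂_ : (F G : ℤ → ℕ → ℤ) → Set
  F ≗₂ G = ∀ c k → F c k ≡ G c k

  Periodic₂ : ℤ → (ℤ → ℕ → ℤ) → Set
  Periodic₂ d F = ∀ k → Periodic d (λ c → F c k)

  Δ⁺ : ℤ → (ℤ → ℕ → ℤ) → ℤ → ℕ → ℤ
  Δ⁺ a F c zero = F c zero
  Δ⁺ a F c (suc k) = F c (suc k) + F (c - a) k

  Δ⁺* : List ℤ → (ℤ → ℕ → ℤ) → ℤ → ℕ → ℤ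
  Δ⁺* [] F = F
  Δ⁺* (a ∷ as) F = Δ⁺ a (Δ⁺* as F)

  Δ⁺-cong : ∀ a {F G} → F ≗₂ G → Δ⁺ a F ≗₂ Δ⁺ a G
  Δ⁺-cong a F≗G c zero = F≗G c zero
  Δ⁺-cong a F≗G c (suc k) = cong₂ _+_ (F≗G c (suc k)) (F≗G (c - a) k)

  Δ⁺*-cong : ∀ as {F G} → F ≗₂ G → Δ⁺* as F ≗₂ Δ⁺* as G
  Δ⁺*-cong [] F≗G = F≗G
  Δ⁺*-cong (a ∷ as) F≗G = Δ⁺-cong a (Δ⁺*-cong as F≗G)

  Δ⁺*-zero : ∀ as F c → Δ⁺* as F c 0 ≡ F c 0
  Δ⁺*-zero [] F c = refl
  Δ⁺*-zero (a ∷ as) F c = Δ⁺*-zero as F c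

  Δ⁺-periodic : ∀ {d} a {F} → Periodic₂ d F → Periodic₂ d (Δ⁺ a F)
  Δ⁺-periodic a F-per zero c = F-per zero c
  Δ⁺-periodic {d} a {F} F-per (suc k) c =
    cong₂ _+_ (F-per (suc k) c) (trans (cong (λ x → F x k) (reorder c d a)) (F-per k (c - a)))
    where
    reorder : ∀ c d a → c + d - a ≡ c - a + d
    reorder = solve-∀

  Δ⁺*-periodic : ∀ {d} as {F} → Periodic₂ d F → Periodic₂ d (Δ⁺* as F)
  Δ⁺*-periodic [] F-per = F-per
  Δ⁺*-periodic (a ∷ as) F-per = Δ⁺-periodic a (Δ⁺*-periodic as F-per)

  Δ⁺-resp-mod : ∀ {d a b F} → Periodic₂ d F → a ≡ b mod d → Δ⁺ a F ≗₂ Δ⁺ b F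
  Δ⁺-resp-mod F-per a≡b c zero = refl
  Δ⁺-resp-mod {d} {a} {b} {F} F-per a≡b c (suc k) =
    cong (λ x → F c (suc k) + x)
      (periodic-resp (F-per k) (congruence (subst (d ∣_) (swap-sub a b c) (ℤD.∣m⇒∣-m (divisibility a≡b)))))
    where
    swap-sub : ∀ a b c → - (a - b) ≡ (c - a) - (c - b)
    swap-sub = solve-∀

  Δ⁺-comm : ∀ a b F → Δ⁺ a (Δ⁺ b F) ≗₂ Δ⁺ b (Δ⁺ a F)
  Δ⁺-comm a b F c zero = refl
  Δ⁺-comm a b F c (suc zero) = exchange (F c 1) (F (c - b) 0) (F (c - a) 0)
    where
    exchange : ∀ x y z → x + y + z ≡ x + z + y
    exchange = solve-∀
  Δ⁺-comm a b F c (suc (suc k)) = begin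
      F c (2 ℕ.+ k) + F (c - b) (suc k) + (F (c - a) (suc k) + F (c - a - b) k)
        ≡⟨ cong (λ x → F c (2 ℕ.+ k) + F (c - b) (suc k) + (F (c - a) (suc k) + F x k)) (reorder c a b) ⟩
      F c (2 ℕ.+ k) + F (c - b) (suc k) + (F (c - a) (suc k) + F (c - b - a) k)
        ≡⟨ exchange (F c (2 ℕ.+ k)) (F (c - b) (suc k)) (F (c - a) (suc k)) (F (c - b - a) k) ⟩
      F c (2 ℕ.+ k) + F (c - a) (suc k) + (F (c - b) (suc k) + F (c - b - a) k)  ∎
    where
    open ≡-Reasoning
    reorder : ∀ c a b → c - a - b ≡ c - b - a
    reorder = solve-∀
    exchange : ∀ x y z w → x + y + (z + w) ≡ x + z + (y + w)
    exchange = solve-∀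

  Δ⁺-resp : ∀ {d a b F G} → Periodic₂ d G → a ≡ b mod d → F ≗₂ G → Δ⁺ a F ≗₂ Δ⁺ b G
  Δ⁺-resp {a = a} G-per a≡b F≗G c k = trans (Δ⁺-cong a F≗G c k) (Δ⁺-resp-mod G-per a≡b c k)

  Δ⁺*-resp-≋ : ∀ {d as bs F} → Periodic₂ d F → Pointwise (_≡_mod d) as bs → Δ⁺* as F ≗₂ Δ⁺* bs F
  Δ⁺*-resp-≋ F-per [] c k = refl
  Δ⁺*-resp-≋ F-per (_∷_ {ys = bs} a≡b as≋bs) =
    Δ⁺-resp (Δ⁺*-periodic bs F-per) a≡b (Δ⁺*-resp-≋ F-per as≋bs)

  Δ⁺*-resp-↭ : ∀ {d as bs F} → Periodic₂ d F → Permutation (_≡_mod d) as bs → Δ⁺* as F ≗₂ Δ⁺* bs F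
  Δ⁺*-resp-↭ F-per (Perm.refl as≋bs) = Δ⁺*-resp-≋ F-per as≋bs
  Δ⁺*-resp-↭ F-per (Perm.prep {ys = bs} a≡b as↭bs) =
    Δ⁺-resp (Δ⁺*-periodic bs F-per) a≡b (Δ⁺*-resp-↭ F-per as↭bs)
  Δ⁺*-resp-↭ {F = F} F-per (Perm.swap {ys = bs} {x} {y} {x′} {y′} x≡x′ y≡y′ as↭bs) c k =
    trans (Δ⁺-cong x (Δ⁺-cong y (Δ⁺*-resp-↭ F-per as↭bs)) c k)
      (trans (Δ⁺-comm x y G c k)
        (Δ⁺-resp (Δ⁺-periodic x′ G-per) y≡y′ (Δ⁺-resp-mod G-per x≡x′) c k))
    where
    G : ℤ → ℕ → ℤ
    G = Δ⁺* bs F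
    G-per : Periodic₂ _ G
    G-per = Δ⁺*-periodic bs F-per
  Δ⁺*-resp-↭ F-per (Perm.trans as↭bs bs↭cs) c k =
    trans (Δ⁺*-resp-↭ F-per as↭bs c k) (Δ⁺*-resp-↭ F-per bs↭cs c k)

  -- twist F is F with y z substituted for y
  twist : (ℤ → ℕ → ℤ) → ℤ → ℕ → ℤ
  twist F c k = F (c - + k) k

  Δ⁺*-twist : ∀ as F → Δ⁺* (map ℤ.suc as) (twist F) ≗₂ twist (Δ⁺* as F)
  Δ⁺*-twist [] F c k = refl
  Δ⁺*-twist (a ∷ as) F c zero = Δ⁺*-twist as F c zero
  Δ⁺*-twist (a ∷ as) F c (suc k) = cong₂ _+_ (Δ⁺*-twist as F c (suc k))
    (trans (Δ⁺*-twist as F (c - ℤ.suc a) k)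
      (cong (λ x → Δ⁺* as F x k) (trans (reorder c a (+ k)) (cong (λ x → c - x - a) (sym (ℤP.pos-+ 1 k))))))
    where
    reorder : ∀ c a k → c - (1ℤ + a) - k ≡ c - (1ℤ + k) - a
    reorder = solve-∀

  VanishesFrom : ℕ → (ℤ → ℕ → ℤ) → Set
  VanishesFrom B F = ∀ c k → B ≤ k → F c k ≡ 0ℤ

  Δ⁺*-vanishes : ∀ as {B F} → VanishesFrom B F → VanishesFrom (length as ℕ.+ B) (Δ⁺* as F)
  Δ⁺*-vanishes [] F-vanishes = F-vanishes
  Δ⁺*-vanishes (a ∷ as) F-vanishes c (suc k) (s≤s B≤k) =
    cong₂ _+_ (Δ⁺*-vanishes as F-vanishes c (suc k) (ℕP.m≤n⇒m≤1+n B≤k)) (Δ⁺*-vanishes as F-vanishes (c - a) k B≤k)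

  eval₋₁ : ℕ → (ℤ → ℕ → ℤ) → ℤ → ℤ
  eval₋₁ B F c = ∑ B (λ k → negOnePow k * F c k)

  eval₋₁-Δ⁺ : ∀ B a F c → eval₋₁ (suc B) (Δ⁺ a F) c ≡ eval₋₁ (suc B) F c - eval₋₁ B F (c - a)
  eval₋₁-Δ⁺ zero a F c = sym (ℤP.+-identityʳ _)
  eval₋₁-Δ⁺ (suc B) a F c = begin
      eval₋₁ (suc B) (Δ⁺ a F) c + - s * (F c (suc B) + F (c - a) B)
        ≡⟨ cong (_+ - s * (F c (suc B) + F (c - a) B)) (eval₋₁-Δ⁺ B a F c) ⟩
      eval₋₁ (suc B) F c - eval₋₁ B F (c - a) + - s * (F c (suc B) + F (c - a) B)
        ≡⟨ regroup (eval₋₁ B F c) (eval₋₁ B F (c - a)) s (F c B) (F c (suc B)) (F (c - a) B) ⟩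
      eval₋₁ (suc B) F c + - s * F c (suc B) - (eval₋₁ B F (c - a) + s * F (c - a) B)  ∎
    where
    open ≡-Reasoning
    s : ℤ
    s = negOnePow B
    regroup : ∀ e e' s x y z → e + s * x - e' + - s * (y + z) ≡ e + s * x + - s * y - (e' + s * z)
    regroup = solve-∀

  eval₋₁-vanishes : ∀ B {F} → VanishesFrom B F → ∀ c → eval₋₁ (suc B) F c ≡ eval₋₁ B F c
  eval₋₁-vanishes B {F} F-vanishes c = begin
      eval₋₁ B F c + negOnePow B * F c B  ≡⟨ cong (λ x → eval₋₁ B F c + negOnePow B * x) (F-vanishes c B ℕP.≤-refl) ⟩
      eval₋₁ B F c + negOnePow B * 0ℤ     ≡⟨ cong (λ x → eval₋₁ B F c + x) (ℤP.*-zeroʳ (negOnePow B)) ⟩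
      eval₋₁ B F c + 0ℤ                   ≡⟨ ℤP.+-identityʳ _ ⟩
      eval₋₁ B F c                        ∎
    where open ≡-Reasoning

  eval₋₁-Δ⁺* : ∀ as {B F} → VanishesFrom B F → eval₋₁ (length as ℕ.+ B) (Δ⁺* as F) ≗ Δ* as (eval₋₁ B F)
  eval₋₁-Δ⁺* [] F-vanishes c = refl
  eval₋₁-Δ⁺* (a ∷ as) {B} {F} F-vanishes c = begin
      eval₋₁ (suc n) (Δ⁺ a G) c
        ≡⟨ eval₋₁-Δ⁺ n a G c ⟩
      eval₋₁ (suc n) G c - eval₋₁ n G (c - a)
        ≡⟨ cong (_- eval₋₁ n G (c - a)) (eval₋₁-vanishes n (Δ⁺*-vanishes as F-vanishes) c) ⟩
      eval₋₁ n G c - eval₋₁ n G (c - a)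
        ≡⟨ cong₂ _-_ (eval₋₁-Δ⁺* as F-vanishes c) (eval₋₁-Δ⁺* as F-vanishes (c - a)) ⟩
      Δ* (a ∷ as) (eval₋₁ B F) c ∎
    where
    open ≡-Reasoning
    n : ℕ
    n = length as ℕ.+ B
    G : ℤ → ℕ → ℤ
    G = Δ⁺* as F

  constantTerm : (ℤ → ℤ) → ℤ → ℕ → ℤ
  constantTerm F c zero = F c
  constantTerm F c (suc k) = 0ℤ

  constantTerm-periodic : ∀ {d F} → Periodic d F → Periodic₂ d (constantTerm F)
  constantTerm-periodic F-per zero = F-per
  constantTerm-periodic F-per (suc k) c = refl

  Δ*≗eval₋₁-Δ⁺* : ∀ as F → Δ* as F ≗ eval₋₁ (length as ℕ.+ 1) (Δ⁺* as (constantTerm F))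
  Δ*≗eval₋₁-Δ⁺* as F c = sym (trans (eval₋₁-Δ⁺* as vanishes c) (Δ*-cong as unit c))
    where
    vanishes : VanishesFrom 1 (constantTerm F)
    vanishes c (suc k) _ = refl
    unit : eval₋₁ 1 (constantTerm F) ≗ F
    unit c = trans (ℤP.+-identityˡ _) (ℤP.*-identityˡ (F c))

  Δ*-resp-↭ : ∀ {d as bs F} → Periodic d F → Permutation (_≡_mod d) as bs → Δ* as F ≗ Δ* bs F
  Δ*-resp-↭ {d} {as} {bs} {F} F-per as↭bs c = begin
      Δ* as F c
        ≡⟨ Δ*≗eval₋₁-Δ⁺* as F c ⟩
      eval₋₁ (length as ℕ.+ 1) (Δ⁺* as (constantTerm F)) c
        ≡⟨ cong (λ n → eval₋₁ (n ℕ.+ 1) (Δ⁺* as (constantTerm F)) c) |as|≡|bs| ⟩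
      eval₋₁ (length bs ℕ.+ 1) (Δ⁺* as (constantTerm F)) c
        ≡⟨ ∑-cong (length bs ℕ.+ 1) (λ k _ → cong (negOnePow k *_) (Δ⁺as≗Δ⁺bs c k)) ⟩
      eval₋₁ (length bs ℕ.+ 1) (Δ⁺* bs (constantTerm F)) c
        ≡⟨ Δ*≗eval₋₁-Δ⁺* bs F c ⟨
      Δ* bs F c ∎
    where
    open ≡-Reasoning
    |as|≡|bs| : length as ≡ length bs
    |as|≡|bs| = ↭ₛ.xs↭ys⇒|xs|≡|ys| (mod-setoid d) as↭bs
    Δ⁺as≗Δ⁺bs : Δ⁺* as (constantTerm F) ≗₂ Δ⁺* bs (constantTerm F)
    Δ⁺as≗Δ⁺bs = Δ⁺*-resp-↭ (constantTerm-periodic F-per) as↭bs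

  -- The product ∏_{0 < a < p} (1 - zᵃ) applied to the indicator of pℤ

  indicator : ∀ {A : Set} → Dec A → ℤ
  indicator (yes _) = 1ℤ
  indicator (no _) = 0ℤ

  δ : ℕ → ℤ → ℤ
  δ p c = indicator (p ℕD.∣? ℤ.∣ c ∣)

  δ-yes : ∀ {p c} → + p ∣ c → δ p c ≡ 1ℤ
  δ-yes {p} {c} p∣c with p ℕD.∣? ℤ.∣ c ∣
  ... | yes _ = refl
  ... | no p∤c = ⊥-elim (p∤c (ℤD.∣⇒∣ᵤ p∣c))

  δ-no : ∀ {p c} → ¬ + p ∣ c → δ p c ≡ 0ℤ
  δ-no {p} {c} p∤c with p ℕD.∣? ℤ.∣ c ∣
  ... | yes p∣c = ⊥-elim (p∤c (ℤD.∣ᵤ⇒∣ p∣c))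
  ... | no _ = refl

  δ-neg : ∀ p c → δ p (- c) ≡ δ p c
  δ-neg p c = cong (λ n → indicator (p ℕD.∣? n)) (ℤP.∣-i∣≡∣i∣ c)

  δ-periodic : ∀ p → Periodic (+ p) (δ p)
  δ-periodic p c with + p ℤD.∣? c
  ... | yes p∣c = trans (δ-yes (ℤD.∣m∣n⇒∣m+n p∣c ℤD.∣-refl)) (sym (δ-yes p∣c))
  ... | no p∤c = trans (δ-no (λ p∣c+p → p∤c (ℤD.∣m+n∣n⇒∣m p∣c+p ℤD.∣-refl))) (sym (δ-no p∤c))

  ∑-δ : ∀ n → ∑ (suc n) (λ r → δ (suc n) (+ r)) ≡ 1ℤ
  ∑-δ n = partial n ℕP.≤-refl
    where
    partial : ∀ k → k ≤ n → ∑ (suc k) (λ r → δ (suc n) (+ r)) ≡ 1ℤ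
    partial zero _ = cong (λ x → 0ℤ + x) (δ-yes {suc n} {0ℤ} (divides 0ℤ refl))
    partial (suc k) k<n = trans (cong₂ _+_ (partial k (ℕP.<⇒≤ k<n)) (δ-no p∤1+k)) (ℤP.+-identityʳ 1ℤ)
      where
      p∤1+k : ¬ + suc n ∣ + suc k
      p∤1+k p∣1+k = ℕP.<⇒≱ (s≤s k<n) (ℕD.∣⇒≤ (ℤD.∣⇒∣ᵤ p∣1+k))

  residues : ℕ → List ℤ
  residues p = applyUpTo +_ p

  nonzeroResidues : ℕ → List ℤ
  nonzeroResidues p = applyUpTo (λ i → + suc i) (ℕ.pred p)

  suc-residues↭residues : ∀ n → Permutation (_≡_mod + suc n) (map ℤ.suc (residues (suc n))) (residues (suc n))
  suc-residues↭residues n =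
    subst (λ xs → Permutation (_≡_mod + suc n) xs (residues (suc n))) (sym shifted)
      (Perm.trans (Perm.refl (Pointwise.++⁺ (≋ₛ.≋-refl (mod-setoid (+ suc n))) (p≡0 ∷ [])))
        (subst (λ ys → Permutation (_≡_mod + suc n) (xs ++ [ 0ℤ ]) (0ℤ ∷ ys)) (++-identityʳ xs)
          (↭ₛ.↭-shift (mod-setoid (+ suc n)) xs [])))
    where
    xs : List ℤ
    xs = applyUpTo (λ i → + suc i) n
    shifted : map ℤ.suc (residues (suc n)) ≡ xs ++ [ + suc n ]
    shifted = trans (map-applyUpTo +_ ℤ.suc (suc n)) (sym (applyUpTo-∷ʳ (λ i → + suc i) n))
    p≡0 : + suc n ≡ 0ℤ mod + suc n
    p≡0 = congruence (divides 1ℤ (trans (ℤP.+-identityʳ (+ suc n)) (sym (ℤP.*-identityˡ (+ suc n)))))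

  ∈-nonzeroResidues : ∀ p .{{_ : NonZero p}} {x} → ¬ + p ∣ x → Any (x ≡_mod + p) (nonzeroResidues p)
  ∈-nonzeroResidues (suc p) {x} p∤x with x %ℕ suc p | a≡a%ℕn+[a/ℕn]*n x (suc p) | n%ℕd<d x (suc p)
  ... | zero  | x≡qp | _ = ⊥-elim (p∤x (divides (x /ℕ suc p) (trans x≡qp (ℤP.+-identityˡ _))))
  ... | suc i | x≡r+qp | s≤s i<p = AnyP.applyUpTo⁺ (λ j → + suc j) x≡r i<p
    where
    x≡r : x ≡ + suc i mod + suc p
    x≡r = congruence (divides (x /ℕ suc p) (trans (cong (_- + suc i) x≡r+qp) (cancel (+ suc i) (x /ℕ suc p * + suc p))))
      where
      cancel : ∀ r y → r + y - r ≡ y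
      cancel = solve-∀

  module SubsetSums (n : ℕ) (p-prime : Prime (2 ℕ.+ n)) where
    p : ℕ
    p = 2 ℕ.+ n

    -- R c k counts the k-element subsets of ℤ/p with sum ≡ c, and W c k those avoiding 0
    R : ℤ → ℕ → ℤ
    R = Δ⁺* (residues p) (constantTerm (δ p))

    W : ℤ → ℕ → ℤ
    W = Δ⁺* (nonzeroResidues p) (constantTerm (δ p))

    δ-periodic₂ : Periodic₂ (+ p) (constantTerm (δ p))
    δ-periodic₂ = constantTerm-periodic (δ-periodic p)

    R≗twist-R : R ≗₂ twist R
    R≗twist-R c k = begin
        R c k
          ≡⟨ Δ⁺*-resp-↭ δ-periodic₂ (suc-residues↭residues (suc n)) c k ⟨
        Δ⁺* (map ℤ.suc (residues p)) (constantTerm (δ p)) c k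
          ≡⟨ Δ⁺*-cong (map ℤ.suc (residues p)) twist-δ c k ⟨
        Δ⁺* (map ℤ.suc (residues p)) (twist (constantTerm (δ p))) c k
          ≡⟨ Δ⁺*-twist (residues p) (constantTerm (δ p)) c k ⟩
        twist R c k ∎
      where
      open ≡-Reasoning
      twist-δ : twist (constantTerm (δ p)) ≗₂ constantTerm (δ p)
      twist-δ c zero = cong (δ p) (ℤP.+-identityʳ c)
      twist-δ c (suc k) = refl

    R-periodic : ∀ k → Periodic (+ k) (λ c → R c k)
    R-periodic k c = trans (R≗twist-R (c + + k) k) (cong (λ x → R x k) (cancel c (+ k)))
      where
      cancel : ∀ c k → c + k - k ≡ c
      cancel = solve-∀

    R-constant : ∀ k → 0 < k → k < p → Constant (λ c → R c k)
    R-constant (suc k) _ k<p =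
      periodic-coprime (prime⇒coprime p-prime k<p) (λ c → Δ⁺*-periodic (residues p) δ-periodic₂ (suc k) c) (R-periodic (suc k))

    W-step : ∀ c k → W c (suc k) ≡ R c (suc k) - W c k
    W-step c k = trans (add-sub (W c (suc k)) (W c k)) (cong (λ x → W c (suc k) + W x k - W c k) (sym (ℤP.+-identityʳ c)))
      where
      add-sub : ∀ x y → x ≡ x + y - y
      add-sub = solve-∀

    W-offset-constant : ∀ k → k < p → Constant (λ c → W c k - negOnePow k * δ p c)
    W-offset-constant zero _ x y = trans (vanish x) (sym (vanish y))
      where
      vanish : ∀ c → W c 0 - 1ℤ * δ p c ≡ 0ℤ
      vanish c = trans (cong (λ w → w - 1ℤ * δ p c) (Δ⁺*-zero (nonzeroResidues p) (constantTerm (δ p)) c)) (self-sub (δ p c))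
        where
        self-sub : ∀ d → d - 1ℤ * d ≡ 0ℤ
        self-sub = solve-∀
    W-offset-constant (suc k) k<p x y = begin
        W x (suc k) - - s * δ p x
          ≡⟨ split x ⟩
        R x (suc k) - (W x k - s * δ p x)
          ≡⟨ cong₂ _-_ (R-constant (suc k) (s≤s z≤n) k<p x y) (W-offset-constant k (ℕP.<-trans (ℕP.n<1+n k) k<p) x y) ⟩
        R y (suc k) - (W y k - s * δ p y)
          ≡⟨ split y ⟨
        W y (suc k) - - s * δ p y ∎
      where
      open ≡-Reasoning
      s : ℤ
      s = negOnePow k
      regroup : ∀ r w s d → r - w - - s * d ≡ r - (w - s * d)
      regroup = solve-∀
      split : ∀ c → W c (suc k) - - s * δ p c ≡ R c (suc k) - (W c k - s * δ p c)
      split c = trans (cong (λ w → w - - s * δ p c) (W-step c k)) (regroup (R c (suc k)) (W c k) s (δ p c))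

    eval-offset-constant : ∀ m → m ≤ p → Constant (λ c → eval₋₁ m W c - + m * δ p c)
    eval-offset-constant zero _ x y = zero-offset (δ p x) (δ p y)
      where
      zero-offset : ∀ d e → 0ℤ - 0ℤ * d ≡ 0ℤ - 0ℤ * e
      zero-offset = solve-∀
    eval-offset-constant (suc m) m<p x y = begin
        eval₋₁ m W x + s * W x m - + suc m * δ p x
          ≡⟨ split x ⟩
        eval₋₁ m W x - + m * δ p x + s * (W x m - s * δ p x)
          ≡⟨ cong₂ (λ e w → e + s * w) (eval-offset-constant m (ℕP.<⇒≤ m<p) x y) (W-offset-constant m m<p x y) ⟩
        eval₋₁ m W y - + m * δ p y + s * (W y m - s * δ p y)
          ≡⟨ split y ⟨
        eval₋₁ m W y + s * W y m - + suc m * δ p y ∎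
      where
      open ≡-Reasoning
      s : ℤ
      s = negOnePow m
      regroup : ∀ e m s w d → e + s * w - (1ℤ + m) * d ≡ e - m * d + s * (w - s * d) + (s * s - 1ℤ) * d
      regroup = solve-∀
      drop-zero : ∀ x d → x + (1ℤ - 1ℤ) * d ≡ x
      drop-zero = solve-∀
      split : ∀ c → eval₋₁ m W c + s * W c m - + suc m * δ p c ≡ eval₋₁ m W c - + m * δ p c + s * (W c m - s * δ p c)
      split c = trans (cong (λ k → eval₋₁ m W c + s * W c m - k * δ p c) (ℤP.pos-+ 1 m))
        (trans (regroup (eval₋₁ m W c) (+ m) s (W c m) (δ p c))
          (trans (cong (λ t → eval₋₁ m W c - + m * δ p c + s * (W c m - s * δ p c) + (t - 1ℤ) * δ p c) (negOnePow-square m))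
            (drop-zero _ (δ p c))))

    K : ℤ
    K = eval₋₁ p W 0ℤ - + p * δ p 0ℤ

    Δ*-nonzeroResidues≡+K : ∀ c → Δ* (nonzeroResidues p) (δ p) c ≡ + p * δ p c + K
    Δ*-nonzeroResidues≡+K c = begin
        Δ* (nonzeroResidues p) (δ p) c
          ≡⟨ Δ*≗eval₋₁-Δ⁺* (nonzeroResidues p) (δ p) c ⟩
        eval₋₁ (length (nonzeroResidues p) ℕ.+ 1) W c
          ≡⟨ cong (λ m → eval₋₁ (m ℕ.+ 1) W c) (length-applyUpTo (λ i → + suc i) (suc n)) ⟩
        eval₋₁ (suc n ℕ.+ 1) W c
          ≡⟨ cong (λ m → eval₋₁ m W c) (ℕP.+-comm (suc n) 1) ⟩
        eval₋₁ p W c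
          ≡⟨ add-sub (eval₋₁ p W c) (+ p * δ p c) ⟩
        + p * δ p c + (eval₋₁ p W c - + p * δ p c)
          ≡⟨ cong (λ x → + p * δ p c + x) (eval-offset-constant p ℕP.≤-refl c 0ℤ) ⟩
        + p * δ p c + K ∎
      where
      open ≡-Reasoning
      add-sub : ∀ e x → e ≡ x + (e - x)
      add-sub = solve-∀

    p*[1+K]≡0 : + p * (1ℤ + K) ≡ 0ℤ
    p*[1+K]≡0 = begin
        + p * (1ℤ + K)
          ≡⟨ ℤP.*-distribˡ-+ (+ p) 1ℤ K ⟩
        + p * 1ℤ + + p * K
          ≡⟨ cong₂ (λ x y → + p * x + y) (∑-δ (suc n)) (∑-const p K) ⟨
        + p * ∑ p (λ r → δ p (+ r)) + ∑ p (λ _ → K)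
          ≡⟨ cong (_+ ∑ p (λ _ → K)) (∑-*ˡ p (+ p) (λ r → δ p (+ r))) ⟨
        ∑ p (λ r → + p * δ p (+ r)) + ∑ p (λ _ → K)
          ≡⟨ ∑-+-distrib p (λ r → + p * δ p (+ r)) (λ _ → K) ⟨
        ∑ p (λ r → + p * δ p (+ r) + K)
          ≡⟨ ∑-cong p (λ r _ → Δ*-nonzeroResidues≡+K (+ r)) ⟨
        ∑ p (λ r → Δ* (nonzeroResidues p) (δ p) (+ r))
          ≡⟨ ∑-Δ₁-periodic (suc n) (Δ*-periodic (applyUpTo (λ i → + suc (suc i)) n) (δ-periodic p)) ⟩
        0ℤ ∎
      where open ≡-Reasoning

    K≡-1 : K ≡ -1ℤ
    K≡-1 = trans (sub-add K) (cong (_- 1ℤ) 1+K≡0)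
      where
      1+K≡0 : 1ℤ + K ≡ 0ℤ
      1+K≡0 = ℤP.*-cancelˡ-≡ (+ p) (1ℤ + K) 0ℤ (trans p*[1+K]≡0 (sym (ℤP.*-zeroʳ (+ p))))
      sub-add : ∀ k → k ≡ 1ℤ + k - 1ℤ
      sub-add = solve-∀

  Δ*-nonzeroResidues : ∀ p → Prime p → ∀ c → Δ* (nonzeroResidues p) (δ p) c ≡ + p * δ p c - 1ℤ
  Δ*-nonzeroResidues 0 p-prime = ⊥-elim (NonTrivial.nonTrivial (prime⇒nonTrivial p-prime))
  Δ*-nonzeroResidues 1 p-prime = ⊥-elim (NonTrivial.nonTrivial (prime⇒nonTrivial p-prime))
  Δ*-nonzeroResidues (suc (suc n)) p-prime c =
    trans (Δ*-nonzeroResidues≡+K c) (cong (λ x → + suc (suc n) * δ (suc (suc n)) c + x) K≡-1)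
    where open SubsetSums n p-prime

  -- Newman sums in terms of Δ

  T : ℕ → ℕ → ℤ → ℤ
  T p k c = ∑ (2 ^ k) (λ r → thueMorse r * δ p (+ r - c))

  powersOf2 : ℕ → List ℤ
  powersOf2 k = applyDownFrom (λ i → + (2 ^ i)) k

  T-zero : ∀ p → T p 0 ≗ δ p
  T-zero p c = trans (ℤP.+-identityˡ _) (trans (ℤP.*-identityˡ _) (trans (cong (δ p) (ℤP.+-identityˡ (- c))) (δ-neg p c)))

  T-suc : ∀ p k → T p (suc k) ≗ Δ (+ (2 ^ k)) (T p k)
  T-suc p k c = begin
      ∑ (2 ^ suc k) g                                  ≡⟨ cong (λ n → ∑ (2 ^ k ℕ.+ n) g) (ℕP.+-identityʳ (2 ^ k)) ⟩
      ∑ (2 ^ k ℕ.+ 2 ^ k) g                            ≡⟨ ∑-+ (2 ^ k) (2 ^ k) g ⟩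
      ∑ (2 ^ k) g + ∑ (2 ^ k) (λ r → g (2 ^ k ℕ.+ r))  ≡⟨ cong (λ x → ∑ (2 ^ k) g + x) upper-half ⟩
      T p k c + - T p k (c - + (2 ^ k))                ∎
    where
    open ≡-Reasoning
    g : ℕ → ℤ
    g r = thueMorse r * δ p (+ r - c)
    shift : ∀ K r c → K + r - c ≡ r - (c - K)
    shift = solve-∀
    negate : ∀ t d → - t * d ≡ -1ℤ * (t * d)
    negate = solve-∀
    upper-half : ∑ (2 ^ k) (λ r → g (2 ^ k ℕ.+ r)) ≡ - T p k (c - + (2 ^ k))
    upper-half = begin
        ∑ (2 ^ k) (λ r → g (2 ^ k ℕ.+ r))
          ≡⟨ ∑-cong (2 ^ k) (λ r r< → trans (cong₂ _*_ (thueMorse-flip k r r<)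
                (cong (δ p) (trans (cong (_- c) (ℤP.pos-+ (2 ^ k) r)) (shift (+ (2 ^ k)) (+ r) c))))
                (negate (thueMorse r) _)) ⟩
        ∑ (2 ^ k) (λ r → -1ℤ * (thueMorse r * δ p (+ r - (c - + (2 ^ k)))))  ≡⟨ ∑-*ˡ (2 ^ k) -1ℤ _ ⟩
        -1ℤ * T p k (c - + (2 ^ k))                                           ≡⟨ ℤP.-1*i≡-i _ ⟩
        - T p k (c - + (2 ^ k))                                               ∎

  T≗Δ*-powersOf2 : ∀ p k → T p k ≗ Δ* (powersOf2 k) (δ p)
  T≗Δ*-powersOf2 p zero = T-zero p
  T≗Δ*-powersOf2 p (suc k) c = trans (T-suc p k c) (Δ*-cong [ + (2 ^ k) ] (T≗Δ*-powersOf2 p k) c)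

  S-suc : ∀ p x → S p (suc x) ≡ S p x + δ p (+ x) * thueMorse x
  S-suc p x with p ℕD.∣? x
  ... | yes _ = cong (λ y → S p x + y) (sym (ℤP.*-identityˡ _))
  ... | no _ = sym (trans (cong (λ y → S p x + y) (ℤP.*-zeroˡ (thueMorse x))) (ℤP.+-identityʳ (S p x)))

  S≡∑ : ∀ p x → S p x ≡ ∑ x (λ n → δ p (+ n) * thueMorse n)
  S≡∑ p zero = refl
  S≡∑ p (suc x) = trans (S-suc p x) (cong (_+ δ p (+ x) * thueMorse x) (S≡∑ p x))

  S-2^k* : ∀ p k x → S p (2 ^ k ℕ.* x) ≡ ∑ x (λ q → thueMorse q * T p k (- + (2 ^ k ℕ.* q)))
  S-2^k* p k x = begin
      S p (2 ^ k ℕ.* x)                                               ≡⟨ S≡∑ p (2 ^ k ℕ.* x) ⟩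
      ∑ (2 ^ k ℕ.* x) h                                               ≡⟨ ∑-blocks (2 ^ k) x h ⟩
      ∑ x (λ q → ∑ (2 ^ k) (λ r → h (2 ^ k ℕ.* q ℕ.+ r)))             ≡⟨ ∑-cong x (λ q _ → block q) ⟩
      ∑ x (λ q → thueMorse q * T p k (- + (2 ^ k ℕ.* q)))             ∎
    where
    open ≡-Reasoning
    h : ℕ → ℤ
    h n = δ p (+ n) * thueMorse n
    shift : ∀ A r → A + r ≡ r - - A
    shift = solve-∀
    reorder : ∀ d a b → d * (a * b) ≡ a * (b * d)
    reorder = solve-∀
    block : ∀ q → ∑ (2 ^ k) (λ r → h (2 ^ k ℕ.* q ℕ.+ r)) ≡ thueMorse q * T p k (- + (2 ^ k ℕ.* q))
    block q = trans (∑-cong (2 ^ k) (λ r r< → trans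
        (cong₂ _*_ (cong (δ p) (trans (ℤP.pos-+ (2 ^ k ℕ.* q) r) (shift (+ (2 ^ k ℕ.* q)) (+ r)))) (thueMorse-split k q r r<))
        (reorder (δ p (+ r - - + (2 ^ k ℕ.* q))) (thueMorse q) (thueMorse r))))
      (∑-*ˡ (2 ^ k) (thueMorse q) _)

  S-transfer : ∀ p k j s → (∀ q → T p k (- + (2 ^ k ℕ.* q)) ≡ s * T p j (- + (2 ^ j ℕ.* q))) →
               ∀ x → S p (2 ^ k ℕ.* x) ≡ s * S p (2 ^ j ℕ.* x)
  S-transfer p k j s Tk≡sTj x = begin
      S p (2 ^ k ℕ.* x)
        ≡⟨ S-2^k* p k x ⟩
      ∑ x (λ q → thueMorse q * T p k (- + (2 ^ k ℕ.* q)))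
        ≡⟨ ∑-cong x (λ q _ → trans (cong (thueMorse q *_) (Tk≡sTj q)) (swap (thueMorse q) s _)) ⟩
      ∑ x (λ q → s * (thueMorse q * T p j (- + (2 ^ j ℕ.* q))))
        ≡⟨ ∑-*ˡ x s _ ⟩
      s * ∑ x (λ q → thueMorse q * T p j (- + (2 ^ j ℕ.* q)))
        ≡⟨ cong (s *_) (S-2^k* p j x) ⟨
      s * S p (2 ^ j ℕ.* x) ∎
    where
    open ≡-Reasoning
    swap : ∀ a b c → a * (b * c) ≡ b * (a * c)
    swap = solve-∀

  sum-powersOf2 : ∀ k → foldr _+_ 0ℤ (powersOf2 k) ≡ + (2 ^ k) - 1ℤ
  sum-powersOf2 zero = refl
  sum-powersOf2 (suc k) =
    trans (cong (λ s → + (2 ^ k) + s) (sum-powersOf2 k)) (trans (double (+ (2 ^ k))) (cong (_- 1ℤ) (sym (ℤP.pos-* 2 (2 ^ k)))))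
    where
    double : ∀ a → a + (a - 1ℤ) ≡ + 2 * a - 1ℤ
    double = solve-∀

  +-∸-≡ : ∀ {a b} → b ≤ a → + a - + b ≡ + (a ∸ b)
  +-∸-≡ {a} {b} b≤a = trans (ℤP.[+m]-[+n]≡m⊖n a b) (ℤP.⊖-≥ b≤a)

  ∣∸⇒≡mod : ∀ {p a b} → b ≤ a → p ℕD.∣ a ∸ b → + a ≡ + b mod + p
  ∣∸⇒≡mod {p} b≤a p∣a∸b = congruence (subst (+ p ∣_) (sym (+-∸-≡ b≤a)) (ℤD.∣ᵤ⇒∣ p∣a∸b))

  ≡mod⇒∣∸ : ∀ {p a b} → b ≤ a → + a ≡ + b mod + p → p ℕD.∣ a ∸ b
  ≡mod⇒∣∸ {p} b≤a a≡b = ℤD.∣⇒∣ᵤ (subst (+ p ∣_) (+-∸-≡ b≤a) (divisibility a≡b))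

  -- 2 is a semiprimitive root of p

  module Semiprimitive (p : ℕ) (p-prime : Prime p) (p≢2 : p ≢ 2) (order : HasOrder 2 p ((p ∸ 1) / 2))
                       (no-1 : ∀ y → ¬ (p ℕD.∣ 2 ^ y ℕ.+ 1)) where

    m : ℕ
    m = (p ∸ 1) / 2

    ε : ℤ
    ε = negOnePow m

    instance
      p-nonZero : NonZero p
      p-nonZero = prime⇒nonZero p-prime

    1<p : 1 < p
    1<p = ℕ.nonTrivial⇒n>1 p {{prime⇒nonTrivial p-prime}}

    p≡1+2m : p ≡ suc (m ℕ.+ m)
    p≡1+2m = trans p≡1+h*2 (cong suc (trans (double h) (cong (λ k → k ℕ.+ k) (sym m≡h))))
      where
      h : ℕ
      h = p / 2
      2∤p : ¬ 2 ℕD.∣ p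
      2∤p 2∣p with prime⇒irreducible p-prime 2∣p
      ... | inj₁ ()
      ... | inj₂ 2≡p = p≢2 (sym 2≡p)
      p%2≡1 : p % 2 ≡ 1
      p%2≡1 with p % 2 | m%n<n p 2 | ℕD.m%n≡0⇒n∣m p 2
      ... | zero | _ | 2∣p = ⊥-elim (2∤p (2∣p refl))
      ... | suc zero | _ | _ = refl
      ... | suc (suc _) | s≤s (s≤s ()) | _
      p≡1+h*2 : p ≡ suc (h ℕ.* 2)
      p≡1+h*2 = trans (m≡m%n+[m/n]*n p 2) (cong (ℕ._+ h ℕ.* 2) p%2≡1)
      m≡h : m ≡ h
      m≡h = trans (cong (λ k → (k ∸ 1) / 2) p≡1+h*2) (m*n/n≡m h 2)
      double : ∀ h → h ℕ.* 2 ≡ h ℕ.+ h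
      double = ℕRing.solve-∀

    p∣2^j*x⇒p∣x : ∀ j x → p ℕD.∣ 2 ^ j ℕ.* x → p ℕD.∣ x
    p∣2^j*x⇒p∣x zero x p∣x = subst (p ℕD.∣_) (ℕP.+-identityʳ x) p∣x
    p∣2^j*x⇒p∣x (suc j) x p∣2^[1+j]x
      with euclidsLemma 2 (2 ^ j ℕ.* x) p-prime (subst (p ℕD.∣_) (ℕP.*-assoc 2 (2 ^ j) x) p∣2^[1+j]x)
    ... | inj₁ p∣2 = ⊥-elim (p≢2 (ℕP.≤-antisym (ℕD.∣⇒≤ p∣2) 1<p))
    ... | inj₂ p∣2^jx = p∣2^j*x⇒p∣x j x p∣2^jx

    2^m≡1 : + (2 ^ m) ≡ 1ℤ mod + p
    2^m≡1 = ∣∸⇒≡mod (ℕP.m^n>0 2 m) (proj₁ (proj₂ order))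

    2^[i+m]≡2^i : ∀ i → + (2 ^ (i ℕ.+ m)) ≡ + (2 ^ i) mod + p
    2^[i+m]≡2^i i =
      ≡mod-trans (≡⇒≡mod split) (≡mod-trans (≡mod-*ˡ (+ (2 ^ i)) 2^m≡1) (≡⇒≡mod (ℤP.*-identityʳ _)))
      where
      split : + (2 ^ (i ℕ.+ m)) ≡ + (2 ^ i) * + (2 ^ m)
      split = trans (cong +_ (ℕP.^-distribˡ-+-* 2 i m)) (ℤP.pos-* (2 ^ i) (2 ^ m))

    2^i≢2^j : ∀ {i j} → j < i → i < m → ¬ + (2 ^ i) ≡ + (2 ^ j) mod + p
    2^i≢2^j {i} {j} j<i i<m 2^i≡2^j =
      proj₂ (proj₂ order) d (ℕP.m<n⇒0<n∸m j<i) (ℕP.≤-<-trans (ℕP.m∸n≤m i j) i<m)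
        (p∣2^j*x⇒p∣x j (2 ^ d ∸ 1) (subst (p ℕD.∣_) factor (≡mod⇒∣∸ (ℕP.^-monoʳ-≤ 2 (ℕP.<⇒≤ j<i)) 2^i≡2^j)))
      where
      d : ℕ
      d = i ∸ j
      factor : 2 ^ i ∸ 2 ^ j ≡ 2 ^ j ℕ.* (2 ^ d ∸ 1)
      factor = sym (trans (ℕP.*-distribˡ-∸ (2 ^ j) (2 ^ d) 1)
        (cong₂ _∸_ (trans (sym (ℕP.^-distribˡ-+-* 2 j d)) (cong (2 ^_) (ℕP.m+[n∸m]≡n (ℕP.<⇒≤ j<i)))) (ℕP.*-identityʳ (2 ^ j))))

    -2^i≢-2^j : ∀ {i j} → j < i → i < m → ¬ - + (2 ^ i) ≡ - + (2 ^ j) mod + p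
    -2^i≢-2^j j<i i<m -2^i≡-2^j =
      2^i≢2^j j<i i<m
        (subst₂ (λ x y → x ≡ y mod + p) (ℤP.neg-involutive _) (ℤP.neg-involutive _) (≡mod-neg -2^i≡-2^j))

    p∤2^k+2^[k+d] : ∀ k d → ¬ p ℕD.∣ 2 ^ k ℕ.+ 2 ^ (k ℕ.+ d)
    p∤2^k+2^[k+d] k d p∣sum = no-1 d (p∣2^j*x⇒p∣x k (2 ^ d ℕ.+ 1) (subst (p ℕD.∣_) factor p∣sum))
      where
      factor : 2 ^ k ℕ.+ 2 ^ (k ℕ.+ d) ≡ 2 ^ k ℕ.* (2 ^ d ℕ.+ 1)
      factor = trans (cong (2 ^ k ℕ.+_) (ℕP.^-distribˡ-+-* 2 k d)) (distrib (2 ^ k) (2 ^ d))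
        where
        distrib : ∀ a b → a ℕ.+ a ℕ.* b ≡ a ℕ.* (b ℕ.+ 1)
        distrib = ℕRing.solve-∀

    p∤2^i+2^j : ∀ i j → ¬ p ℕD.∣ 2 ^ i ℕ.+ 2 ^ j
    p∤2^i+2^j i j p∣sum with ℕP.≤-total i j
    ... | inj₁ i≤j = p∤2^k+2^[k+d] i (j ∸ i) (subst (λ e → p ℕD.∣ 2 ^ i ℕ.+ 2 ^ e) (sym (ℕP.m+[n∸m]≡n i≤j)) p∣sum)
    ... | inj₂ j≤i = p∤2^k+2^[k+d] j (i ∸ j)
      (subst (λ e → p ℕD.∣ 2 ^ j ℕ.+ 2 ^ e) (sym (ℕP.m+[n∸m]≡n j≤i)) (subst (p ℕD.∣_) (ℕP.+-comm (2 ^ i) (2 ^ j)) p∣sum))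

    -2^i≢2^j : ∀ i j → ¬ - + (2 ^ i) ≡ + (2 ^ j) mod + p
    -2^i≢2^j i j -2^i≡2^j = p∤2^i+2^j i j (ℤD.∣⇒∣ᵤ (subst (+ p ∣_) negate (ℤD.∣m⇒∣-m (divisibility -2^i≡2^j))))
      where
      negate : - (- + (2 ^ i) - + (2 ^ j)) ≡ + (2 ^ i ℕ.+ 2 ^ j)
      negate = trans (negsum (+ (2 ^ i)) (+ (2 ^ j))) (sym (ℤP.pos-+ (2 ^ i) (2 ^ j)))
        where
        negsum : ∀ a b → - (- a - b) ≡ a + b
        negsum = solve-∀

    p∤2^i : ∀ i → ¬ + p ∣ + (2 ^ i)
    p∤2^i i p∣2^i = ℕP.<⇒≢ 1<p (sym (ℕD.∣1⇒≡1 (p∣2^j*x⇒p∣x i 1 p∣2^i*1)))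
      where
      p∣2^i*1 : p ℕD.∣ 2 ^ i ℕ.* 1
      p∣2^i*1 = subst (p ℕD.∣_) (sym (ℕP.*-identityʳ (2 ^ i))) (ℤD.∣⇒∣ᵤ p∣2^i)

    p∤-2^i : ∀ i → ¬ + p ∣ - + (2 ^ i)
    p∤-2^i i p∣-2^i = p∤2^i i (subst (+ p ∣_) (ℤP.neg-involutive _) (ℤD.∣m⇒∣-m p∣-2^i))

    H : List ℤ
    H = powersOf2 m

    -H++H↭nonzeroResidues : Permutation (_≡_mod + p) (map -_ H ++ H) (nonzeroResidues p)
    -H++H↭nonzeroResidues = distinct-⊆⇒↭ (mod-setoid (+ p)) distinct covered same-length
      where
      distinct : AllPairs (λ x y → ¬ x ≡ y mod + p) (map -_ H ++ H)
      distinct = AllPairsP.++⁺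
        (AllPairsP.map⁺ (AllPairsP.applyDownFrom⁺₁ (λ i → + (2 ^ i)) m -2^i≢-2^j))
        (AllPairsP.applyDownFrom⁺₁ (λ i → + (2 ^ i)) m 2^i≢2^j)
        (AllP.map⁺ (AllP.applyDownFrom⁺₂ (λ i → + (2 ^ i)) m
          (λ i → AllP.applyDownFrom⁺₂ (λ j → + (2 ^ j)) m (-2^i≢2^j i))))
      covered : All (λ x → Any (x ≡_mod + p) (nonzeroResidues p)) (map -_ H ++ H)
      covered = AllP.++⁺
        (AllP.map⁺ (AllP.applyDownFrom⁺₂ (λ i → + (2 ^ i)) m (λ i → ∈-nonzeroResidues p (p∤-2^i i))))
        (AllP.applyDownFrom⁺₂ (λ i → + (2 ^ i)) m (λ i → ∈-nonzeroResidues p (p∤2^i i)))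
      same-length : length (map -_ H ++ H) ≡ length (nonzeroResidues p)
      same-length = begin
          length (map -_ H ++ H)         ≡⟨ length-++ (map -_ H) ⟩
          length (map -_ H) ℕ.+ length H ≡⟨ cong₂ ℕ._+_ (trans (length-map -_ H) |H|≡m) |H|≡m ⟩
          m ℕ.+ m                        ≡⟨ cong ℕ.pred p≡1+2m ⟨
          ℕ.pred p                       ≡⟨ length-applyUpTo (λ i → + suc i) (ℕ.pred p) ⟨
          length (nonzeroResidues p)     ∎
        where
        open ≡-Reasoning
        |H|≡m : length H ≡ m
        |H|≡m = length-applyDownFrom (λ i → + (2 ^ i)) m

    Δ*-H : ∀ {F} → Periodic (+ p) F → ∀ c → Δ* H F c ≡ ε * Δ* (map -_ H) F c
    Δ*-H {F} F-per c = sym (begin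
        ε * Δ* (map -_ H) F c
          ≡⟨ cong (ε *_) (Δ*-neg H F c) ⟩
        ε * (negOnePow (length H) * Δ* H F (c + Σ))
          ≡⟨ cong (λ k → ε * (negOnePow k * Δ* H F (c + Σ))) (length-applyDownFrom (λ i → + (2 ^ i)) m) ⟩
        ε * (ε * Δ* H F (c + Σ))
          ≡⟨ ℤP.*-assoc ε ε _ ⟨
        ε * ε * Δ* H F (c + Σ)
          ≡⟨ cong₂ _*_ (negOnePow-square m) (periodic-resp (Δ*-periodic H F-per) c+Σ≡c) ⟩
        1ℤ * Δ* H F c
          ≡⟨ ℤP.*-identityˡ _ ⟩
        Δ* H F c ∎)
      where
      open ≡-Reasoning
      Σ : ℤ
      Σ = foldr _+_ 0ℤ H
      cancel : ∀ c s → c + s - c ≡ s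
      cancel = solve-∀
      c+Σ≡c : c + Σ ≡ c mod + p
      c+Σ≡c = congruence (subst (+ p ∣_) (sym (trans (cancel c Σ) (sum-powersOf2 m))) (divisibility 2^m≡1))

    Δ*-H-H : ∀ c → Δ* H (Δ* H (δ p)) c ≡ ε * (+ p * δ p c - 1ℤ)
    Δ*-H-H c = begin
        Δ* H (Δ* H (δ p)) c                ≡⟨ Δ*-H (Δ*-periodic H (δ-periodic p)) c ⟩
        ε * Δ* (map -_ H) (Δ* H (δ p)) c   ≡⟨ cong (ε *_) (Δ*-++ (map -_ H) H (δ p) c) ⟨
        ε * Δ* (map -_ H ++ H) (δ p) c     ≡⟨ cong (ε *_) (Δ*-resp-↭ (δ-periodic p) -H++H↭nonzeroResidues c) ⟩
        ε * Δ* (nonzeroResidues p) (δ p) c ≡⟨ cong (ε *_) (Δ*-nonzeroResidues p p-prime c) ⟩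
        ε * (+ p * δ p c - 1ℤ)             ∎
      where open ≡-Reasoning

    powersOf2-+m : ∀ a → Pointwise (_≡_mod + p) (powersOf2 (a ℕ.+ m)) (powersOf2 a ++ H)
    powersOf2-+m zero = ≋ₛ.≋-refl (mod-setoid (+ p))
    powersOf2-+m (suc a) = 2^[i+m]≡2^i a ∷ powersOf2-+m a

    powersOf2-p : Pointwise (_≡_mod + p) (powersOf2 p) (1ℤ ∷ H ++ H)
    powersOf2-p = subst (λ k → Pointwise (_≡_mod + p) (powersOf2 k) (1ℤ ∷ H ++ H)) (sym p≡1+2m)
      (≡mod-trans (2^[i+m]≡2^i m) 2^m≡1 ∷ powersOf2-+m m)

    T-p≡εpT-1 : ∀ c → T p p c ≡ ε * + p * T p 1 c
    T-p≡εpT-1 c = begin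
        T p p c                                   ≡⟨ T≗Δ*-powersOf2 p p c ⟩
        Δ* (powersOf2 p) (δ p) c                  ≡⟨ Δ*-resp-↭ (δ-periodic p) (Perm.refl powersOf2-p) c ⟩
        Δ 1ℤ (Δ* (H ++ H) (δ p)) c                ≡⟨ Δ*-cong [ 1ℤ ] (λ c → trans (Δ*-++ H H (δ p) c) (Δ*-H-H c)) c ⟩
        Δ 1ℤ (λ c → ε * (+ p * δ p c - 1ℤ)) c     ≡⟨ factor ε (+ p) (δ p c) (δ p (c - 1ℤ)) ⟩
        ε * + p * Δ 1ℤ (δ p) c                    ≡⟨ cong (ε * + p *_) (T≗Δ*-powersOf2 p 1 c) ⟨
        ε * + p * T p 1 c                         ∎
      where
      open ≡-Reasoning
      factor : ∀ e P x y → e * (P * x - 1ℤ) - e * (P * y - 1ℤ) ≡ e * P * (x - y)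
      factor = solve-∀

    T-1-periodic : Periodic (+ p) (T p 1)
    T-1-periodic c = trans (T≗Δ*-powersOf2 p 1 (c + + p))
      (trans (Δ*-periodic (powersOf2 1) (δ-periodic p) c) (sym (T≗Δ*-powersOf2 p 1 c)))

    2^p*q≡2*q : ∀ q → + (2 ^ p ℕ.* q) ≡ + (2 ℕ.* q) mod + p
    2^p*q≡2*q q =
      ≡mod-trans (≡⇒≡mod split) (≡mod-trans (≡mod-*ˡ (+ (2 ℕ.* q)) 2^2m≡1) (≡⇒≡mod (ℤP.*-identityʳ _)))
      where
      2^2m≡1 : + (2 ^ (m ℕ.+ m)) ≡ 1ℤ mod + p
      2^2m≡1 = ≡mod-trans (2^[i+m]≡2^i m) 2^m≡1
      regroup : ∀ P q → 2 ℕ.* P ℕ.* q ≡ 2 ℕ.* q ℕ.* P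
      regroup = ℕRing.solve-∀
      split : + (2 ^ p ℕ.* q) ≡ + (2 ℕ.* q) * + (2 ^ (m ℕ.+ m))
      split = trans (cong (λ e → + (2 ^ e ℕ.* q)) p≡1+2m)
        (trans (cong +_ (regroup (2 ^ (m ℕ.+ m)) q)) (ℤP.pos-* (2 ℕ.* q) (2 ^ (m ℕ.+ m))))

    T-p-at-powers : ∀ q → T p p (- + (2 ^ p ℕ.* q)) ≡ ε * + p * T p 1 (- + (2 ^ 1 ℕ.* q))
    T-p-at-powers q = trans (T-p≡εpT-1 (- + (2 ^ p ℕ.* q)))
      (cong (ε * + p *_) (periodic-resp T-1-periodic (≡mod-neg (2^p*q≡2*q q))))


open import Defs
open import Data.Nat using (ℕ; _+_; _*_; _∸_; _^_; _/_)
open import Data.Nat.Primality using (Prime)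
open import Data.Nat.Divisibility using (_∣_)
open import Data.Integer as ℤ using (ℤ)
open import Relation.Nullary using (¬_)
open import Relation.Binary.PropositionalEquality using (_≡_; _≢_)
open import Relation.Binary.PropositionalEquality using (module ≡-Reasoning)
import Data.Integer.Properties as ℤP
open Newman using (S-transfer; module Semiprimitive)

theorem2 : (p : ℕ) → Prime p → p ≢ 2
    → HasOrder 2 p ((p ∸ 1) / 2)
    → (∀ (y : ℕ) → ¬ (p ∣ 2 ^ y + 1))
    → ∀ (x : ℕ) → S p (2 ^ p * x) ≡ negOnePow ((p ∸ 1) / 2) ℤ.* (ℤ.+ p ℤ.* S p (2 * x))
theorem2 p p-prime p≢2 order no-1 x = begin
    S p (2 ^ p * x)                      ≡⟨ S-transfer p p 1 (ε ℤ.* ℤ.+ p) T-p-at-powers x ⟩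
    ε ℤ.* ℤ.+ p ℤ.* S p (2 * x)          ≡⟨ ℤP.*-assoc ε (ℤ.+ p) (S p (2 * x)) ⟩
    ε ℤ.* (ℤ.+ p ℤ.* S p (2 * x))        ∎
  where
  open ≡-Reasoning
  open Semiprimitive p p-prime p≢2 order no-1
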